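{- Assume the Dickson–Hardy–Littlewood conjecture: for every finite admissible set $H\subset\mathbb{N}$ there exist infinitely many $n\in\mathbb{N}$ with $n+H\subset\mathbb{P}$. Let $H\subset\mathbb{N}$ be a finite admissible set, let $q$ be a squarefree natural number, and let $a\in\mathbb{N}$ be such that $\gcd(a+h,q)=1$ for all $h\in H$. Then there exist infinitely many $n\in\mathbb{N}$ such that $n+H\subset\mathbb{P}$ and $n\equiv a\pmod q$.
   Context: $\mathbb{P}$ denotes the set of primes and $n+H=\{n+h:h\in H\}$. A (finite or infinite) set $H\subset\mathbb{N}$ is admissible if for every prime $p$ there exists $i\in\mathbb{N}$ such that no element of $H$ is congruent to $i$ modulo $p$. -}

module Defs where

open import Data.Nat using (ℕ; _+_; _*_; _≥_)
open import Data.Nat.Divisibility using (_∣_)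
open import Data.Nat.GCD using (gcd)
open import Data.Nat.Primality using (Prime)
open import Data.List using (List)
open import Data.List.Membership.Propositional using (_∈_)
open import Data.Product using (∃; Σ; _×_)
open import Data.Sum using (_⊎_)
open import Relation.Binary.PropositionalEquality using (_≡_)
open import Relation.Nullary using (¬_)

-- x ≡ y (mod m), total in m (for m = 0 it is equality)
_≡_[mod_] : ℕ → ℕ → ℕ → Set
x ≡ y [mod m ] = ∃ λ k → (x + k * m ≡ y) ⊎ (y + k * m ≡ x)

-- A finite set H ⊂ ℕ is represented by a list of its elements.
-- Admissible: for every prime p some residue class i mod p misses H.
Admissible : List ℕ → Set
Admissible H = ∀ p → Prime p → ∃ λ i → ∀ h → h ∈ H → ¬ (h ≡ i [mod p ])

ShiftPrime : List ℕ → ℕ → Set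
ShiftPrime H n = ∀ h → h ∈ H → Prime (n + h)

SquareFree : ℕ → Set
SquareFree q = ∀ d → d * d ∣ q → d ≡ 1

DHL : Set
DHL = ∀ (H : List ℕ) → Admissible H → ∀ N → ∃ λ n → n ≥ N × ShiftPrime H n

{-# OPTIONS --safe #-}
module Submission where

-- Fix h₀ ∈ H. For every prime p ∣ q add to H the shifts h₀ + stride_p s
-- (s < q) with a + h₀ + stride_p s coprime to q, where stride_p = K (q / p)
-- and K is the product of the numbers up to a bound B ≥ |H⁺| that are coprime
-- to q. The enlarged set H⁺ is still admissible: primes dividing q miss the
-- class of -a, primes up to B not dividing q divide K and so see every new
-- shift in the class of h₀, and larger primes exceed |H⁺|. DHL gives n > q
-- with n + H⁺ ⊂ ℙ. If a prime p ∣ q did not divide n - a, then as p ∤ stride_p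
-- we could pick s < p with p ∣ n + h₀ + stride_p s; this shift x lies in H⁺,
-- because a + x is prime to p (it differs from n + x by n - a) and agrees with
-- a + h₀ modulo every other prime of q. Then n + x would be a prime multiple
-- of p larger than p. So all prime factors of q divide n - a, hence so does q.

open import Defs
open import Data.Nat using (ℕ; zero; suc; pred; _+_; _*_; _∸_; _≤_; _<_; _≥_; _≟_; _≤?_; s≤s; ∣_-_∣; NonZero; ≢-nonZero; ≢-nonZero⁻¹)
open import Data.Nat.Properties
open import Data.Nat.DivMod using (_/_; _%_; m≡m%n+[m/n]*n; [m+kn]%n≡m%n; %-remove-+ʳ; m%n<n; m<n⇒m%n≡m; m/n*n≡m)
open import Data.Nat.Divisibility
open import Data.Nat.GCD using (gcd; gcd[m,n]∣m; gcd[m,n]∣n; gcd[m,n]≢0; gcd-greatest; module Bézout)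
open import Data.Nat.Coprimality using (Coprime; coprime-Bézout; coprime-divisor; coprime⇒gcd≡1)
import Data.Nat.Coprimality as Coprimality
open import Data.Nat.Primality using (Prime; prime?; euclidsLemma; prime⇒irreducible; ¬prime[1]; prime⇒nonZero)
open import Data.Nat.Primality.Factorisation using (factorise)
open import Data.Nat.ListAction using (product)
open import Data.Nat.ListAction.Properties using (∈⇒∣product)
open import Data.Nat.Tactic.RingSolver using (solve-∀)
open import Data.List using (List; []; _∷_; length; map; filter; upTo; _++_; cartesianProductWith)
open import Data.List.Properties using (length-++; length-map; length-upTo; length-filter; filter-notAll)
open import Data.List.Relation.Unary.All using (All; _∷_; lookup)
open import Data.List.Relation.Unary.Any as Any using (here; there)
open import Data.List.Membership.Propositional using (_∈_; _∉_)
open import Data.List.Membership.Propositional.Properties using (∈-filter⁺; ∈-filter⁻; ∈-map⁺; ∈-upTo⁺; ∈-++⁺ˡ; ∈-++⁺ʳ; ∈-++⁻; ∈-cartesianProductWith⁺; ∈-cartesianProductWith⁻)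
open import Data.List.Membership.DecPropositional _≟_ using (_∈?_)
open import Data.Product using (∃; ∃₂; _×_; _,_; proj₁; proj₂)
open import Data.Sum using (inj₁; inj₂)
open import Data.Empty using (⊥-elim)
open import Function using (_∘_)
open import Relation.Nullary using (¬_; yes; no; contradiction)
open import Relation.Nullary.Decidable using (_×-dec_; ¬?)
open import Relation.Binary.PropositionalEquality

AvoidsClass : ℕ → ℕ → List ℕ → Set
AvoidsClass p i H = ∀ h → h ∈ H → ¬ (h ≡ i [mod p ])

≡[mod]⇒%≡ : ∀ {x y p} .{{_ : NonZero p}} → x ≡ y [mod p ] → x % p ≡ y % p
≡[mod]⇒%≡ {x} {y} {p} (k , inj₁ x+kp≡y) = trans (sym ([m+kn]%n≡m%n x k p)) (cong (_% p) x+kp≡y)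
≡[mod]⇒%≡ {x} {y} {p} (k , inj₂ y+kp≡x) = trans (cong (_% p) (sym y+kp≡x)) ([m+kn]%n≡m%n y k p)

∣∣m-n∣⇒≡[mod] : ∀ {m n q} → q ∣ ∣ m - n ∣ → m ≡ n [mod q ]
∣∣m-n∣⇒≡[mod] {m} {n} (divides k ∣m-n∣≡kq) with ≤-total n m
... | inj₁ n≤m = k , inj₂ (begin
  n + k * _      ≡⟨ cong (n +_) (trans (sym ∣m-n∣≡kq) (m≤n⇒∣n-m∣≡n∸m n≤m)) ⟩
  n + (m ∸ n)    ≡⟨ m+[n∸m]≡n n≤m ⟩
  m              ∎)
  where open ≡-Reasoning
... | inj₂ m≤n = k , inj₁ (begin
  m + k * _      ≡⟨ cong (m +_) (trans (sym ∣m-n∣≡kq) (m≤n⇒∣m-n∣≡n∸m m≤n)) ⟩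
  m + (n ∸ m)    ≡⟨ m+[n∸m]≡n m≤n ⟩
  n              ∎)
  where open ≡-Reasoning

%≡⇒≡[mod] : ∀ x y p .{{_ : NonZero p}} → x % p ≡ y % p → x ≡ y [mod p ]
%≡⇒≡[mod] x y p x%p≡y%p = ∣∣m-n∣⇒≡[mod] (divides ∣ x / p - y / p ∣ (begin
  ∣ x - y ∣                                         ≡⟨ cong₂ ∣_-_∣ (m≡m%n+[m/n]*n x p) (m≡m%n+[m/n]*n y p) ⟩
  ∣ x % p + x / p * p - y % p + y / p * p ∣         ≡⟨ cong (λ r → ∣ x % p + x / p * p - r + y / p * p ∣) (sym x%p≡y%p) ⟩
  ∣ x % p + x / p * p - x % p + y / p * p ∣         ≡⟨ ∣m+n-m+o∣≡∣n-o∣ (x % p) _ _ ⟩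
  ∣ x / p * p - y / p * p ∣                         ≡⟨ *-distribʳ-∣-∣ p (x / p) (y / p) ⟨
  ∣ x / p - y / p ∣ * p                             ∎))
  where open ≡-Reasoning

+-congˡ-≡[mod] : ∀ (a : ℕ) {x y p} → x ≡ y [mod p ] → (a + x) ≡ (a + y) [mod p ]
+-congˡ-≡[mod] a {x} {y} {p} (k , inj₁ x+kp≡y) = k , inj₁ (trans (+-assoc a x (k * p)) (cong (a +_) x+kp≡y))
+-congˡ-≡[mod] a {x} {y} {p} (k , inj₂ y+kp≡x) = k , inj₂ (trans (+-assoc a y (k * p)) (cong (a +_) y+kp≡x))

≡[mod]-resp-∣ : ∀ {x y p} → x ≡ y [mod p ] → p ∣ y → p ∣ x
≡[mod]-resp-∣ {x} {p = p} (k , inj₁ x+kp≡y) p∣y =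
  ∣m+n∣m⇒∣n (subst (p ∣_) (trans (sym x+kp≡y) (+-comm x (k * p))) p∣y) (n∣m*n k)
≡[mod]-resp-∣ {p = p} (k , inj₂ y+kp≡x) p∣y = subst (p ∣_) y+kp≡x (∣m∣n⇒∣m+n p∣y (n∣m*n k))

∣m∣n⇒∣m∸n : ∀ {d m n} → d ∣ m → d ∣ n → d ∣ m ∸ n
∣m∣n⇒∣m∸n {d} (divides-refl a) (divides-refl b) = divides (a ∸ b) (sym (*-distribʳ-∸ d a b))

∣m∣n⇒∣∣m-n∣ : ∀ {d m n} → d ∣ m → d ∣ n → d ∣ ∣ m - n ∣
∣m∣n⇒∣∣m-n∣ {d} {m} {n} d∣m d∣n with ∣m-n∣≡[m∸n]∨[n∸m] m n
... | inj₁ ∣m-n∣≡m∸n = subst (d ∣_) (sym ∣m-n∣≡m∸n) (∣m∣n⇒∣m∸n d∣m d∣n)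
... | inj₂ ∣m-n∣≡n∸m = subst (d ∣_) (sym ∣m-n∣≡n∸m) (∣m∣n⇒∣m∸n d∣n d∣m)

∣m+o∧∣n+o⇒∣∣m-n∣ : ∀ {d} m n o → d ∣ m + o → d ∣ n + o → d ∣ ∣ m - n ∣
∣m+o∧∣n+o⇒∣∣m-n∣ {d} m n o d∣m+o d∣n+o =
  subst (d ∣_) (∣m+n-m+o∣≡∣n-o∣ o m n)
    (∣m∣n⇒∣∣m-n∣ (subst (d ∣_) (+-comm m o) d∣m+o) (subst (d ∣_) (+-comm n o) d∣n+o))

length-filter-≢ : ∀ {n} {L : List ℕ} → n ∈ L → length (filter (λ x → ¬? (x ≟ n)) L) < length L
length-filter-≢ n∈L = filter-notAll (λ x → ¬? (x ≟ _)) _ (Any.map (λ n≡x x≢n → x≢n (sym n≡x)) n∈L)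

length≤⇒∃∉≤ : ∀ n (L : List ℕ) → length L ≤ n → ∃ λ i → i ≤ n × i ∉ L
length≤⇒∃∉≤ n L _ with n ∈? L
... | no n∉L = n , ≤-refl , n∉L
length≤⇒∃∉≤ zero L |L|≤0 | yes 0∈L = contradiction (<-≤-trans (length-filter-≢ 0∈L) |L|≤0) λ ()
length≤⇒∃∉≤ (suc m) L |L|≤1+m | yes 1+m∈L
  with i , i≤m , i∉L′ ← length≤⇒∃∉≤ m (filter (λ x → ¬? (x ≟ suc m)) L) (≤-pred (<-≤-trans (length-filter-≢ 1+m∈L) |L|≤1+m))
  = i , m≤n⇒m≤1+n i≤m , λ i∈L → i∉L′ (∈-filter⁺ (λ x → ¬? (x ≟ suc m)) i∈L (<⇒≢ (s≤s i≤m)))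

length<⇒∃AvoidsClass : ∀ p .{{_ : NonZero p}} (H : List ℕ) → length H < p → ∃ λ i → AvoidsClass p i H
length<⇒∃AvoidsClass p H |H|<p with i , i≤|H| , i∉H%p ← length≤⇒∃∉≤ (length H) (map (_% p) H) (≤-reflexive (length-map (_% p) H)) =
  i , λ h h∈H h≡i → i∉H%p (subst (_∈ map (_% p) H) (trans (≡[mod]⇒%≡ h≡i) (m<n⇒m%n≡m (≤-<-trans i≤|H| |H|<p))) (∈-map⁺ (_% p) h∈H))

length-cartesianProductWith : ∀ {a b c} {A : Set a} {B : Set b} {C : Set c} (f : A → B → C) xs ys →
                              length (cartesianProductWith f xs ys) ≡ length xs * length ys
length-cartesianProductWith f [] ys = refl
length-cartesianProductWith f (x ∷ xs) ys = begin
  length (map (f x) ys ++ cartesianProductWith f xs ys)           ≡⟨ length-++ (map (f x) ys) ⟩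
  length (map (f x) ys) + length (cartesianProductWith f xs ys)  ≡⟨ cong₂ _+_ (length-map (f x) ys) (length-cartesianProductWith f xs ys) ⟩
  length ys + length xs * length ys                              ∎
  where open ≡-Reasoning

prime≢1 : ∀ {p} → Prime p → p ≢ 1
prime≢1 pp refl = ¬prime[1] pp

prime∣prime⇒≡ : ∀ {p r} → Prime p → Prime r → p ∣ r → p ≡ r
prime∣prime⇒≡ pp pr p∣r with prime⇒irreducible pr p∣r
... | inj₁ p≡1 = contradiction p≡1 (prime≢1 pp)
... | inj₂ p≡r = p≡r

prime∤⇒coprime : ∀ {p m} → Prime p → ¬ p ∣ m → Coprime p m
prime∤⇒coprime pp p∤m {d} (d∣p , d∣m) with prime⇒irreducible pp d∣p
... | inj₁ d≡1 = d≡1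
... | inj₂ refl = contradiction d∣m p∤m

gcd≡1∧∣⇒∤ : ∀ {p m n} → Prime p → gcd m n ≡ 1 → p ∣ m → ¬ p ∣ n
gcd≡1∧∣⇒∤ pp gcd≡1 p∣m p∣n = prime≢1 pp (∣1⇒≡1 (subst (_ ∣_) gcd≡1 (gcd-greatest p∣m p∣n)))

∃-prime-divisor : ∀ n .{{_ : NonZero n}} → n ≢ 1 → ∃ λ p → Prime p × p ∣ n
∃-prime-divisor n n≢1 with factorise n
... | record { factors = [] ; isFactorisation = n≡1 } = contradiction n≡1 n≢1
... | record { factors = p ∷ ps ; isFactorisation = n≡p*∏ ; factorsPrime = pp ∷ _ } =
  p , pp , subst (p ∣_) (sym n≡p*∏) (m∣m*n (product ps))

no-common-prime⇒gcd≡1 : ∀ m n .{{_ : NonZero n}} → (∀ p → Prime p → p ∣ n → ¬ p ∣ m) → gcd m n ≡ 1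
no-common-prime⇒gcd≡1 m n no-common with gcd m n ≟ 1
... | yes gcd≡1 = gcd≡1
... | no gcd≢1
  with p , pp , p∣gcd ← ∃-prime-divisor (gcd m n) {{≢-nonZero (gcd[m,n]≢0 m n (inj₂ (≢-nonZero⁻¹ n)))}} gcd≢1
  = ⊥-elim (no-common p pp (∣-trans p∣gcd (gcd[m,n]∣n m n)) (∣-trans p∣gcd (gcd[m,n]∣m m n)))

prime∣product⇒∃∈∣ : ∀ {p} ms → Prime p → p ∣ product ms → ∃ λ m → m ∈ ms × p ∣ m
prime∣product⇒∃∈∣ [] pp p∣1 = contradiction (∣1⇒≡1 p∣1) (prime≢1 pp)
prime∣product⇒∃∈∣ (m ∷ ms) pp p∣m*∏ with euclidsLemma m (product ms) pp p∣m*∏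
... | inj₁ p∣m = m , here refl , p∣m
... | inj₂ p∣∏ with m′ , m′∈ms , p∣m′ ← prime∣product⇒∃∈∣ ms pp p∣∏ = m′ , there m′∈ms , p∣m′

prime∣m⇒∣m/p : ∀ {p r m} .{{_ : NonZero p}} → Prime p → Prime r → r ≢ p → p ∣ m → r ∣ m → r ∣ m / p
prime∣m⇒∣m/p {p} {r} {m} pp pr r≢p p∣m r∣m
  with euclidsLemma (m / p) p pr (subst (r ∣_) (sym (m/n*n≡m p∣m)) r∣m)
... | inj₁ r∣m/p = r∣m/p
... | inj₂ r∣p = contradiction (prime∣prime⇒≡ pr pp r∣p) r≢p

coprime∧∣∧∣⇒*∣ : ∀ {m n d} → Coprime m n → m ∣ d → n ∣ d → m * n ∣ d
coprime∧∣∧∣⇒*∣ {m} {n} coprime m∣kn (divides-refl k) =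
  *-monoˡ-∣ n (coprime-divisor coprime (subst (m ∣_) (*-comm k n) m∣kn))

-- Bézout makes x an inverse of m (first case) or of -m (second case) modulo p,
-- so s ≡ -x c resp. s = x c solves c + m s ≡ 0.
∃-root-c+m*s : ∀ {p m} → Prime p → ¬ p ∣ m → ∀ c → ∃ λ s → p ∣ c + m * s
∃-root-c+m*s {suc p′} {m} pp p∤m c with coprime-Bézout (Coprimality.sym (prime∤⇒coprime pp p∤m))
... | Bézout.+- x y 1+yp≡xm = x * (p′ * c) , divides (c + y * (p′ * c)) (begin
  c + m * (x * (p′ * c))            ≡⟨ reassoc c m x (p′ * c) ⟩
  c + x * m * (p′ * c)              ≡⟨ cong (λ t → c + t * (p′ * c)) 1+yp≡xm ⟨
  c + (1 + y * suc p′) * (p′ * c)   ≡⟨ factor c y p′ ⟩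
  (c + y * (p′ * c)) * suc p′       ∎)
  where
  open ≡-Reasoning
  reassoc : ∀ c m x t → c + m * (x * t) ≡ c + x * m * t
  reassoc = solve-∀
  factor : ∀ c y p′ → c + (1 + y * suc p′) * (p′ * c) ≡ (c + y * (p′ * c)) * suc p′
  factor = solve-∀
... | Bézout.-+ x y 1+xm≡yp = x * c , divides (c * y) (begin
  c + m * (x * c)   ≡⟨ factor c m x ⟩
  c * (1 + x * m)   ≡⟨ cong (c *_) 1+xm≡yp ⟩
  c * (y * suc p′)  ≡⟨ *-assoc c y (suc p′) ⟨
  c * y * suc p′    ∎)
  where
  open ≡-Reasoning
  factor : ∀ c m x → c + m * (x * c) ≡ c * (1 + x * m)
  factor = solve-∀

∃-root<p-c+m*s : ∀ {p m} → Prime p → ¬ p ∣ m → ∀ c → ∃ λ s → s < p × p ∣ c + m * s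
∃-root<p-c+m*s {p} {m} pp p∤m c with s , p∣c+ms ← ∃-root-c+m*s pp p∤m c =
  s % p , m%n<n s p , ∣m+n∣m⇒∣n (subst (p ∣_) split p∣c+ms) (n∣m*n (m * (s / p)))
  where
  instance _ = prime⇒nonZero pp
  split : c + m * s ≡ m * (s / p) * p + (c + m * (s % p))
  split = trans (cong (λ t → c + m * t) (m≡m%n+[m/n]*n s p)) (regroup c m (s % p) (s / p) p)
    where
    regroup : ∀ c m r t p → c + m * (r + t * p) ≡ m * t * p + (c + m * r)
    regroup = solve-∀

squareFree⇒nonZero : ∀ {q} → SquareFree q → NonZero q
squareFree⇒nonZero {zero} sf = contradiction (sf 2 (4 ∣0)) λ ()
squareFree⇒nonZero {suc _} _ = _

squareFree-∣ : ∀ {m n} → m ∣ n → SquareFree n → SquareFree m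
squareFree-∣ m∣n sf d d*d∣m = sf d (∣-trans d*d∣m m∣n)

squareFree⇒∤/ : ∀ {p q} .{{_ : NonZero p}} → SquareFree q → Prime p → p ∣ q → ¬ p ∣ q / p
squareFree⇒∤/ sf pp p∣q p∣q/p = prime≢1 pp (sf _ (m∣n/o⇒m*o∣n p∣q p∣q/p))

squareFree-product-∣ : ∀ {d} ps → All Prime ps → SquareFree (product ps) → (∀ {p} → p ∈ ps → p ∣ d) → product ps ∣ d
squareFree-product-∣ [] _ _ _ = 1∣ _
squareFree-product-∣ (p ∷ ps) (pp ∷ pps) sf ∣d =
  coprime∧∣∧∣⇒*∣ (prime∤⇒coprime pp p∤∏) (∣d (here refl))
    (squareFree-product-∣ ps pps (squareFree-∣ (n∣m*n p) sf) (∣d ∘ there))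
  where
  p∤∏ : ¬ p ∣ product ps
  p∤∏ p∣∏ = prime≢1 pp (sf p (*-monoʳ-∣ p p∣∏))

squareFree⇒∣ : ∀ {q d} → SquareFree q → (∀ p → Prime p → p ∣ q → p ∣ d) → q ∣ d
squareFree⇒∣ {q} sf prime∣d with factorise q {{squareFree⇒nonZero sf}}
... | record { factors = ps ; isFactorisation = q≡∏ ; factorsPrime = pps } =
  subst (_∣ _) (sym q≡∏)
    (squareFree-product-∣ ps pps (subst SquareFree q≡∏ sf)
      λ p∈ps → prime∣d _ (lookup pps p∈ps) (subst (_ ∣_) (sym q≡∏) (∈⇒∣product p∈ps)))

AvoidsClass-∣ : ∀ {p q a} (H : List ℕ) → Prime p → p ∣ q → (∀ h → h ∈ H → gcd (a + h) q ≡ 1) → AvoidsClass p (pred p * a) H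
AvoidsClass-∣ {suc _} {a = a} H pp p∣q coprime h h∈H h≡-a =
  gcd≡1∧∣⇒∤ pp (coprime h h∈H) (≡[mod]-resp-∣ (+-congˡ-≡[mod] a h≡-a) (m∣m*n a)) p∣q

module Enlargement (h₀ : ℕ) (H₀ : List ℕ) (q : ℕ) (sf : SquareFree q) (a : ℕ)
                   (coprime : ∀ h → h ∈ h₀ ∷ H₀ → gcd (a + h) q ≡ 1) where

  instance
    q≢0 : NonZero q
    q≢0 = squareFree⇒nonZero sf

  H : List ℕ
  H = h₀ ∷ H₀

  primeDivisors : List ℕ
  primeDivisors = filter (λ p → prime? p ×-dec p ∣? q) (upTo (suc q))

  bound : ℕ
  bound = length H + length primeDivisors * q

  K : ℕ
  K = product (filter (λ m → gcd m q ≟ 1) (upTo (suc bound)))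

  -- The value at p = 0 is junk: only prime p matter.
  stride : ℕ → ℕ
  stride zero = 0
  stride p@(suc _) = K * (q / p)

  candidate : ℕ → ℕ → ℕ
  candidate p s = h₀ + stride p * s

  extra : List ℕ
  extra = filter (λ x → gcd (a + x) q ≟ 1) (cartesianProductWith candidate primeDivisors (upTo q))

  H⁺ : List ℕ
  H⁺ = H ++ extra

  ∈-primeDivisors⁺ : ∀ {p} → Prime p → p ∣ q → p ∈ primeDivisors
  ∈-primeDivisors⁺ pp p∣q = ∈-filter⁺ (λ p → prime? p ×-dec p ∣? q) (∈-upTo⁺ (s≤s (∣⇒≤ p∣q))) (pp , p∣q)

  ∈-extra⁺ : ∀ {p s} → Prime p → p ∣ q → s < q → gcd (a + candidate p s) q ≡ 1 → candidate p s ∈ extra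
  ∈-extra⁺ pp p∣q s<q gcd≡1 = ∈-filter⁺ (λ x → gcd (a + x) q ≟ 1)
    (∈-cartesianProductWith⁺ candidate (∈-primeDivisors⁺ pp p∣q) (∈-upTo⁺ s<q)) gcd≡1

  ∈-extra⁻ : ∀ {x} → x ∈ extra → gcd (a + x) q ≡ 1 × ∃₂ λ p s → x ≡ candidate p s
  ∈-extra⁻ x∈extra with x∈products , gcd≡1 ← ∈-filter⁻ (λ x → gcd (a + x) q ≟ 1) {xs = cartesianProductWith candidate primeDivisors (upTo q)} x∈extra
    with p , s , _ , _ , x≡candidate ← ∈-cartesianProductWith⁻ candidate primeDivisors (upTo q) x∈products
    = gcd≡1 , p , s , x≡candidate

  length-H⁺ : length H⁺ ≤ bound
  length-H⁺ = begin
    length (H ++ extra)                                  ≡⟨ length-++ H ⟩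
    length H + length extra                              ≤⟨ +-monoʳ-≤ (length H) (length-filter (λ x → gcd (a + x) q ≟ 1) (cartesianProductWith candidate primeDivisors (upTo q))) ⟩
    length H + length (cartesianProductWith candidate primeDivisors (upTo q))
                                                         ≡⟨ cong (length H +_) (length-cartesianProductWith candidate primeDivisors (upTo q)) ⟩
    length H + length primeDivisors * length (upTo q)    ≡⟨ cong (λ l → length H + length primeDivisors * l) (length-upTo q) ⟩
    bound                                                ∎
    where open ≤-Reasoning

  H⁺-coprime : ∀ h → h ∈ H⁺ → gcd (a + h) q ≡ 1
  H⁺-coprime h h∈H⁺ with ∈-++⁻ H h∈H⁺
  ... | inj₁ h∈H = coprime h h∈H
  ... | inj₂ h∈extra = proj₁ (∈-extra⁻ h∈extra)

  prime∤q⇒∣K : ∀ {p} → Prime p → ¬ p ∣ q → p ≤ bound → p ∣ K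
  prime∤q⇒∣K pp p∤q p≤bound = ∈⇒∣product
    (∈-filter⁺ (λ m → gcd m q ≟ 1) (∈-upTo⁺ (s≤s p≤bound)) (coprime⇒gcd≡1 (prime∤⇒coprime pp p∤q)))

  prime∣q⇒∤K : ∀ {p} → Prime p → p ∣ q → ¬ p ∣ K
  prime∣q⇒∤K pp p∣q p∣K with m , m∈ , p∣m ← prime∣product⇒∃∈∣ _ pp p∣K =
    gcd≡1∧∣⇒∤ pp (proj₂ (∈-filter⁻ (λ m → gcd m q ≟ 1) {xs = upTo (suc bound)} m∈)) p∣m p∣q

  ∣K⇒∣stride : ∀ {d} r → d ∣ K → d ∣ stride r
  ∣K⇒∣stride zero _ = _ ∣0
  ∣K⇒∣stride (suc _) d∣K = ∣m⇒∣m*n _ d∣K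

  prime∣q⇒∤stride : ∀ {p} → Prime p → p ∣ q → ¬ p ∣ stride p
  prime∣q⇒∤stride {suc _} pp p∣q p∣stride with euclidsLemma K (q / _) pp p∣stride
  ... | inj₁ p∣K = prime∣q⇒∤K pp p∣q p∣K
  ... | inj₂ p∣q/p = squareFree⇒∤/ sf pp p∣q p∣q/p

  prime∣q⇒∣stride : ∀ {p r} → Prime p → Prime r → r ≢ p → p ∣ q → r ∣ q → r ∣ stride p
  prime∣q⇒∣stride {suc _} pp pr r≢p p∣q r∣q = ∣n⇒∣m*n K (prime∣m⇒∣m/p pp pr r≢p p∣q r∣q)

  AvoidsClass-extra : ∀ {p i} → Prime p → ¬ p ∣ q → p ≤ bound → AvoidsClass p i H → AvoidsClass p i H⁺
  AvoidsClass-extra {p} {i} pp p∤q p≤bound avoids h h∈H⁺ h≡i with ∈-++⁻ H h∈H⁺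
  ... | inj₁ h∈H = avoids h h∈H h≡i
  ... | inj₂ h∈extra with _ , r , s , refl ← ∈-extra⁻ h∈extra =
    avoids h₀ (here refl) (%≡⇒≡[mod] h₀ i p (trans (sym h₀+stride%p≡h₀%p) (≡[mod]⇒%≡ h≡i)))
    where
    instance _ = prime⇒nonZero pp
    h₀+stride%p≡h₀%p : candidate r s % p ≡ h₀ % p
    h₀+stride%p≡h₀%p = %-remove-+ʳ h₀ (∣m⇒∣m*n s (∣K⇒∣stride r (prime∤q⇒∣K pp p∤q p≤bound)))

  admissible⁺ : Admissible H → Admissible H⁺
  admissible⁺ adm p pp with p ∣? q | p ≤? bound
  ... | yes p∣q | _ = pred p * a , AvoidsClass-∣ H⁺ pp p∣q H⁺-coprime
  ... | no p∤q | yes p≤bound with i , avoids ← adm p pp = i , AvoidsClass-extra pp p∤q p≤bound avoids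
  ... | no _ | no p≰bound =
    length<⇒∃AvoidsClass p {{prime⇒nonZero pp}} H⁺ (≤-<-trans length-H⁺ (≰⇒> p≰bound))

  candidate-coprime : ∀ {p s} → Prime p → p ∣ q → ¬ p ∣ a + candidate p s → gcd (a + candidate p s) q ≡ 1
  candidate-coprime {p} {s} pp p∣q p∤a+x = no-common-prime⇒gcd≡1 _ q no-common
    where
    no-common : ∀ r → Prime r → r ∣ q → ¬ r ∣ a + candidate p s
    no-common r pr r∣q r∣a+x with r ≟ p
    ... | yes refl = p∤a+x r∣a+x
    ... | no r≢p = gcd≡1∧∣⇒∤ pr (coprime h₀ (here refl)) r∣a+h₀ r∣q
      where
      r∣a+h₀ : r ∣ a + h₀
      r∣a+h₀ = ∣m+n∣m⇒∣n (subst (r ∣_) (+-comm (a + h₀) _) (subst (r ∣_) (sym (+-assoc a h₀ _)) r∣a+x))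
                 (∣m⇒∣m*n s (prime∣q⇒∣stride pp pr r≢p p∣q r∣q))

  ∃-extra-hit : ∀ {n p} → Prime p → p ∣ q → ¬ p ∣ ∣ n - a ∣ → ∃ λ x → x ∈ extra × p ∣ n + x
  ∃-extra-hit {n} {p} pp p∣q p∤n-a
    with s , s<p , p∣n+h₀+ms ← ∃-root<p-c+m*s pp (prime∣q⇒∤stride pp p∣q) (n + h₀) =
    candidate p s , ∈-extra⁺ pp p∣q (<-≤-trans s<p (∣⇒≤ p∣q)) (candidate-coprime pp p∣q p∤a+x) , p∣n+x
    where
    p∣n+x : p ∣ n + candidate p s
    p∣n+x = subst (p ∣_) (+-assoc n h₀ _) p∣n+h₀+ms
    p∤a+x : ¬ p ∣ a + candidate p s
    p∤a+x p∣a+x = p∤n-a (∣m+o∧∣n+o⇒∣∣m-n∣ n a _ p∣n+x p∣a+x)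

  ShiftPrime⇒≡a : ∀ {n} → q < n → ShiftPrime H⁺ n → n ≡ a [mod q ]
  ShiftPrime⇒≡a {n} q<n n+H⁺⊆ℙ = ∣∣m-n∣⇒≡[mod] (squareFree⇒∣ sf prime∣n-a)
    where
    prime∣n-a : ∀ p → Prime p → p ∣ q → p ∣ ∣ n - a ∣
    prime∣n-a p pp p∣q with p ∣? ∣ n - a ∣
    ... | yes p∣n-a = p∣n-a
    ... | no p∤n-a with x , x∈extra , p∣n+x ← ∃-extra-hit pp p∣q p∤n-a =
      contradiction (prime∣prime⇒≡ pp (n+H⁺⊆ℙ x (∈-++⁺ʳ H x∈extra)) p∣n+x)
        (<⇒≢ (≤-<-trans (∣⇒≤ p∣q) (<-≤-trans q<n (m≤m+n n x))))

  DHL⇒∃ShiftPrime≡a : DHL → Admissible H → ∀ N → ∃ λ n → n ≥ N × ShiftPrime H n × n ≡ a [mod q ]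
  DHL⇒∃ShiftPrime≡a dhl adm N with n , n≥N+1+q , n+H⁺⊆ℙ ← dhl H⁺ (admissible⁺ adm) (N + suc q) =
    n , ≤-trans (m≤m+n N (suc q)) n≥N+1+q
      , (λ h h∈H → n+H⁺⊆ℙ h (∈-++⁺ˡ h∈H))
      , ShiftPrime⇒≡a (≤-trans (m≤n+m (suc q) N) n≥N+1+q) n+H⁺⊆ℙ

lemmaB4 : DHL → (H : List ℕ) → Admissible H → (q : ℕ) → SquareFree q → (a : ℕ) → (∀ h → h ∈ H → gcd (a + h) q ≡ 1) → ∀ N → ∃ λ n → n ≥ N × ShiftPrime H n × n ≡ a [mod q ]
lemmaB4 _ [] _ q sf a _ N =
  a + N * q , ≤-trans (m≤m*n N q {{squareFree⇒nonZero sf}}) (m≤n+m (N * q) a) , (λ _ ()) , N , inj₂ refl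
lemmaB4 dhl (h₀ ∷ H₀) adm q sf a coprime = Enlargement.DHL⇒∃ShiftPrime≡a h₀ H₀ q sf a coprime dhl adm
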